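{- Let $\mathbf a=(a_n)_{n\ge1}$ be a strong divisibility sequence. Then for every positive integer $n$, $$\operatorname{lcm}(a_1,a_2,\dots,a_n)=\operatorname{lcm}\left\{a_1\binom{n}{1}_{\mathbf a},\,a_2\binom{n}{2}_{\mathbf a},\dots,a_n\binom{n}{n}_{\mathbf a}\right\}.$$
   Context: A sequence $(a_n)_{n\ge1}$ of positive integers is a strong divisibility sequence if $\gcd(a_n,a_m)=a_{\gcd(n,m)}$ for all positive integers $n,m$. For integers $0\le k\le n$, $\binom{n}{k}_{\mathbf a}:=\frac{a_na_{n-1}\cdots a_{n-k+1}}{a_1a_2\cdots a_k}$ (empty products equal $1$). -}

module Defs where

open import Data.Nat using (ℕ; zero; suc; _*_; _∸_; _+_; NonZero)
open import Data.Nat.GCD using (gcd)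
open import Data.Nat.LCM using (lcm)
open import Data.Nat.Divisibility using (_∣_)
open import Data.Nat.DivMod using (_/_)
open import Relation.Binary.PropositionalEquality using (_≡_)

-- sequences indexed from 1: a : ℕ → ℕ, value at 0 is ignored
StrongDivisibilitySequence : (ℕ → ℕ) → Set
StrongDivisibilitySequence a =
  (∀ n → NonZero n → NonZero (a n)) ×' (∀ n m → NonZero n → NonZero m → gcd (a n) (a m) ≡ a (gcd n m))
  where
    open import Data.Product using () renaming (_×_ to _×'_)

denom : (ℕ → ℕ) → ℕ → ℕ
denom a zero = 1
denom a (suc k) = denom a k * a (suc k)

numer : (ℕ → ℕ) → ℕ → ℕ → ℕ
numer a n zero = 1
numer a n (suc k) = numer a n k * a (n ∸ k)

lcmUpTo : (ℕ → ℕ) → ℕ → ℕ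
lcmUpTo f zero = 1
lcmUpTo f (suc n) = lcm (lcmUpTo f n) (f (suc n))

-- natural division with the convention x ÷ 0 = 0 (only used where the
-- divisor is nonzero and divides exactly, as asserted in the statement)
_div_ : ℕ → ℕ → ℕ
m div zero = 0
m div (suc d) = m / suc d

binomA : (ℕ → ℕ) → ℕ → ℕ → ℕ
binomA a n k = numer a n k div denom a k

-- For d > 0 the indices i > 0 with d ∣ a i are closed under multiples and, since gcd (a i) (a j) = a (gcd i j),
-- under gcd; so they are the multiples of the least one, the rank r of d. Writing the exponent of a prime p in
-- a product as Σ_{j ≥ 1} #{factors divisible by p ^ j}, each term for the window a (m + 1), …, a (m + k)
-- counts multiples of a rank in (m, m + k], and such a window contains at least as many multiples of r as
-- [1, k] does; hence a 1 ⋯ a k divides a (m + 1) ⋯ a (m + k). Adding the index k adds at most one multiple.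
-- So if p ^ (1 + e) divides a k * binomA a n k but no a i with 0 < i ≤ n, only j ≤ e contribute and the
-- exponent of p in a k * a n ⋯ a (n - k + 1) exceeds the one in a 1 ⋯ a k by at most e, although
-- p ^ (1 + e) * a 1 ⋯ a k divides a k * a n ⋯ a (n - k + 1).
-- Thus every prime power dividing a k * binomA a n k divides lcmUpTo a n, and the converse divisibility
-- is immediate.
module Submission where

open import Defs
open import Data.Nat using (ℕ; _*_; _≤_; NonZero)
open import Data.Nat.Divisibility using (_∣_)
open import Data.Product using (_×_)
open import Relation.Binary.PropositionalEquality using (_≡_)

open import Data.Nat using (zero; suc; _+_; _∸_; _^_; _<_; _⊓_; pred; z≤n; s≤s; z<s; >-nonZero; nonTrivial⇒n>1)
open import Data.Nat.Properties
open import Data.Nat.Divisibility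
  using (divides; _∣?_; ∣-refl; ∣-trans; ∣-antisym; 1∣_; ∣1⇒≡1; ∣⇒≤; ∣m+n∣m⇒∣n; ∣m∣n⇒∣m+n; n∣m*n; m∣m*n;
         m*n∣⇒m∣; *-pres-∣; *-monoʳ-∣; *-monoˡ-∣; *-cancelʳ-∣; *-cancelˡ-∣; n∣m⇒m%n≡0)
open import Data.Nat.DivMod using (_/_; _%_; m*[n/m]≡n; m≡m%n+[m/n]*n; m%n<n)
open import Data.Nat.GCD using (gcd; gcd[m,n]∣m; gcd[m,n]∣n; gcd-greatest; gcd[m,n]≤n; gcd[m,n]≢0)
open import Data.Nat.LCM using (m∣lcm[m,n]; n∣lcm[m,n]; lcm-least)
open import Data.Nat.Primality
  using (Prime; euclidsLemma; prime⇒irreducible; prime⇒nonZero; prime⇒nonTrivial)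
open import Data.Nat.Primality.Factorisation using (factorise; PrimeFactorisation)
open import Data.Nat.ListAction using (product)
open import Data.Nat.ListAction.Properties using (product≢0)
open import Data.List using (List; []; _∷_; _++_; map; applyDownFrom)
open import Data.List.Membership.Propositional using (_∈_)
open import Data.List.Membership.Propositional.Properties using (∈-applyDownFrom⁻)
open import Data.List.Relation.Unary.All using (All; []; _∷_; tabulate)
open import Data.List.Relation.Unary.All.Properties using (map⁺)
open import Data.List.Relation.Unary.Any using (here; there)
open import Data.Product using (_,_; ∃; ∃₂; proj₁; proj₂)
open import Data.Sum using (_⊎_; inj₁; inj₂; [_,_]′)
open import Function using (_∘_)
open import Function.Bundles using (_⇔_; mk⇔; Equivalence)
open import Relation.Nullary using (Dec; yes; no; ¬_; contradiction)
open import Relation.Unary using (Decidable)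
open import Relation.Binary.PropositionalEquality
  using (_≢_; refl; sym; trans; cong; cong₂; subst; subst₂; module ≡-Reasoning)
import Algebra.Properties.CommutativeSemigroup as CommutativeSemigroupProperties
open CommutativeSemigroupProperties +-commutativeSemigroup using (interchange; x∙yz≈y∙xz; x∙yz≈xz∙y; xy∙z≈xz∙y)
module *-Props = CommutativeSemigroupProperties *-commutativeSemigroup

-- Counting multiples in windows

indicator : {P : Set} → Dec P → ℕ
indicator (yes _) = 1
indicator (no _)  = 0

indicator≤1 : {P : Set} (P? : Dec P) → indicator P? ≤ 1
indicator≤1 (yes _) = ≤-refl
indicator≤1 (no _)  = z≤n

indicator-no : {P : Set} (P? : Dec P) → ¬ P → indicator P? ≡ 0
indicator-no (yes p) ¬p = contradiction p ¬p
indicator-no (no _)  _  = refl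

indicator-cong : {P Q : Set} (P? : Dec P) (Q? : Dec Q) → P ⇔ Q → indicator P? ≡ indicator Q?
indicator-cong (yes _) (yes _) _   = refl
indicator-cong (yes p) (no ¬q) P⇔Q = contradiction (Equivalence.to P⇔Q p) ¬q
indicator-cong (no ¬p) (yes q) P⇔Q = contradiction (Equivalence.from P⇔Q q) ¬p
indicator-cong (no _)  (no _)  _   = refl

count : {P : ℕ → Set} → Decidable P → List ℕ → ℕ
count P? []       = 0
count P? (i ∷ is) = indicator (P? i) + count P? is

count-++ : {P : ℕ → Set} (P? : Decidable P) (is js : List ℕ) →
           count P? (is ++ js) ≡ count P? is + count P? js
count-++ P? []       js = refl
count-++ P? (i ∷ is) js =
  trans (cong (indicator (P? i) +_) (count-++ P? is js)) (sym (+-assoc (indicator (P? i)) _ _))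

count-cong : {P Q : ℕ → Set} (P? : Decidable P) (Q? : Decidable Q) (is : List ℕ) →
             (∀ {i} → i ∈ is → P i ⇔ Q i) → count P? is ≡ count Q? is
count-cong P? Q? []       _   = refl
count-cong P? Q? (i ∷ is) P⇔Q =
  cong₂ _+_ (indicator-cong (P? i) (Q? i) (P⇔Q (here refl))) (count-cong P? Q? is (P⇔Q ∘ there))

count-none : {P : ℕ → Set} (P? : Decidable P) (is : List ℕ) →
             (∀ {i} → i ∈ is → ¬ P i) → count P? is ≡ 0
count-none P? []       _  = refl
count-none P? (i ∷ is) ¬P =
  cong₂ _+_ (indicator-no (P? i) (¬P (here refl))) (count-none P? is (¬P ∘ there))

countDivisible : (ℕ → ℕ) → ℕ → List ℕ → ℕ
countDivisible f d = count (λ i → d ∣? f i)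

-- window lo len = [lo + len, …, lo + 1]
window : ℕ → ℕ → List ℕ
window lo = applyDownFrom (λ j → suc (lo + j))

∈-window : ∀ {lo len i} → i ∈ window lo len → lo < i × i ≤ lo + len
∈-window {lo} i∈ with ∈-applyDownFrom⁻ (λ j → suc (lo + j)) i∈
... | j , j<len , refl = s≤s (m≤m+n lo j) , +-monoʳ-< lo j<len

∈-window⇒>0 : ∀ {lo len i} → i ∈ window lo len → 0 < i
∈-window⇒>0 i∈ = ≤-trans (s≤s z≤n) (proj₁ (∈-window i∈))

∈-k∷window : ∀ {m k i} → 0 < k → i ∈ k ∷ window m k → 0 < i × i ≤ m + k
∈-k∷window {m} {k} 0<k (here refl) = 0<k , m≤n+m k m
∈-k∷window 0<k (there i∈)         = ∈-window⇒>0 i∈ , proj₂ (∈-window i∈)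

window-++ : ∀ lo a b → window lo (a + b) ≡ window (lo + b) a ++ window lo b
window-++ lo zero    b = refl
window-++ lo (suc a) b = cong₂ _∷_ (cong suc lo+[a+b]≡lo+b+a) (window-++ lo a b)
  where
  lo+[a+b]≡lo+b+a : lo + (a + b) ≡ lo + b + a
  lo+[a+b]≡lo+b+a = trans (cong (lo +_) (+-comm a b)) (sym (+-assoc lo b a))

module Multiples (r : ℕ) .{{_ : NonZero r}} where

  multiples : ℕ → ℕ → ℕ
  multiples lo len = count (r ∣?_) (window lo len)

  multiples-++ : ∀ lo a b → multiples lo (a + b) ≡ multiples (lo + b) a + multiples lo b
  multiples-++ lo a b =
    trans (cong (count (r ∣?_)) (window-++ lo a b))
          (count-++ (r ∣?_) (window (lo + b) a) (window lo b))

  ∣+r⇔∣ : ∀ x → r ∣ x + r ⇔ r ∣ x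
  ∣+r⇔∣ x = mk⇔ (λ r∣x+r → ∣m+n∣m⇒∣n (subst (r ∣_) (+-comm x r) r∣x+r) ∣-refl)
                (λ r∣x → ∣m∣n⇒∣m+n r∣x ∣-refl)

  multiples-periodic : ∀ lo len → multiples (lo + r) len ≡ multiples lo len
  multiples-periodic lo zero      = refl
  multiples-periodic lo (suc len) =
    cong₂ _+_ (indicator-cong (r ∣? _) (r ∣? _) shifted) (multiples-periodic lo len)
    where
    shifted : r ∣ suc (lo + r + len) ⇔ r ∣ suc (lo + len)
    shifted = subst (λ x → r ∣ suc x ⇔ r ∣ suc (lo + len)) (xy∙z≈xz∙y lo len r)
                    (∣+r⇔∣ (suc (lo + len)))

  multiples-+* : ∀ x q len → multiples (x + q * r) len ≡ multiples x len
  multiples-+* x zero    len = cong (λ y → multiples y len) (+-identityʳ x)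
  multiples-+* x (suc q) len = begin
    multiples (x + (r + q * r)) len ≡⟨ cong (λ y → multiples y len) (x∙yz≈xz∙y x r (q * r)) ⟩
    multiples (x + q * r + r) len   ≡⟨ multiples-periodic (x + q * r) len ⟩
    multiples (x + q * r) len       ≡⟨ multiples-+* x q len ⟩
    multiples x len                 ∎
    where open ≡-Reasoning

  multiples-mod : ∀ lo len → multiples lo len ≡ multiples (lo % r) len
  multiples-mod lo len =
    trans (cong (λ y → multiples y len) (m≡m%n+[m/n]*n lo r)) (multiples-+* (lo % r) (lo / r) len)

  multiples-initial : ∀ len → len < r → multiples 0 len ≡ 0
  multiples-initial len len<r = count-none (r ∣?_) (window 0 len) λ i∈ r∣i →
    let 0<i , i≤len = ∈-window i∈ in
    <⇒≱ len<r (≤-trans (∣⇒≤ {{>-nonZero 0<i}} r∣i) i≤len)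

  multiples-decompose : ∀ lo len → multiples lo len ≡ multiples 0 len + multiples len (lo % r)
  multiples-decompose lo len = begin
    multiples lo len                  ≡⟨ multiples-mod lo len ⟩
    multiples s len                   ≡⟨ +-identityʳ _ ⟨
    multiples s len + 0               ≡⟨ cong (multiples s len +_) (multiples-initial s (m%n<n lo r)) ⟨
    multiples s len + multiples 0 s   ≡⟨ multiples-++ 0 len s ⟨
    multiples 0 (len + s)             ≡⟨ cong (multiples 0) (+-comm len s) ⟩
    multiples 0 (s + len)             ≡⟨ multiples-++ 0 s len ⟩
    multiples len s + multiples 0 len ≡⟨ +-comm (multiples len s) _ ⟩
    multiples 0 len + multiples len s ∎
    where
    open ≡-Reasoning
    s = lo % r

  multiples-initial≤ : ∀ lo len → multiples 0 len ≤ multiples lo len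
  multiples-initial≤ lo len =
    subst (multiples 0 len ≤_) (sym (multiples-decompose lo len)) (m≤m+n _ _)

  multiples-r≤1 : multiples 0 r ≤ 1
  multiples-r≤1 = subst (λ x → multiples 0 x ≤ 1) (suc-pred r) (begin
    indicator (r ∣? suc (pred r)) + multiples 0 (pred r)
      ≡⟨ cong (indicator (r ∣? suc (pred r)) +_) (multiples-initial (pred r) pred<r) ⟩
    indicator (r ∣? suc (pred r)) + 0 ≡⟨ +-identityʳ _ ⟩
    indicator (r ∣? suc (pred r))     ≤⟨ indicator≤1 (r ∣? suc (pred r)) ⟩
    1                                 ∎)
    where
    open ≤-Reasoning
    pred<r : pred r < r
    pred<r = subst (pred r <_) (suc-pred r) (n<1+n (pred r))

  multiples-initial≤1 : ∀ x → x < r + r → multiples 0 x ≤ 1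
  multiples-initial≤1 x x<2r with x <? r
  ... | yes x<r = ≤-trans (≤-reflexive (multiples-initial x x<r)) z≤n
  ... | no x≮r = begin
    multiples 0 x                       ≡⟨ cong (multiples 0) (m∸n+n≡m r≤x) ⟨
    multiples 0 (x ∸ r + r)             ≡⟨ multiples-++ 0 (x ∸ r) r ⟩
    multiples r (x ∸ r) + multiples 0 r ≡⟨ cong (_+ multiples 0 r) (multiples-periodic 0 (x ∸ r)) ⟩
    multiples 0 (x ∸ r) + multiples 0 r ≡⟨ cong (_+ multiples 0 r) (multiples-initial _ x∸r<r) ⟩
    multiples 0 r                       ≤⟨ multiples-r≤1 ⟩
    1                                   ∎
    where
    open ≤-Reasoning
    r≤x : r ≤ x
    r≤x = ≮⇒≥ x≮r
    x∸r<r : x ∸ r < r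
    x∸r<r = +-cancelʳ-< r (x ∸ r) r (subst (_< r + r) (sym (m∸n+n≡m r≤x)) x<2r)

  multiples≤1 : ∀ lo len → len ≤ r → multiples lo len ≤ 1
  multiples≤1 lo len len≤r = begin
    multiples lo len                ≡⟨ multiples-mod lo len ⟩
    multiples s len                 ≤⟨ m≤m+n _ _ ⟩
    multiples s len + multiples 0 s ≡⟨ multiples-++ 0 len s ⟨
    multiples 0 (len + s)           ≤⟨ multiples-initial≤1 _ (+-mono-≤-< len≤r (m%n<n lo r)) ⟩
    1                               ∎
    where
    open ≤-Reasoning
    s = lo % r

  indicator+multiples≤ : ∀ lo k → indicator (r ∣? k) + multiples lo k ≤ multiples 0 k + 1
  indicator+multiples≤ lo k = begin
    indicator (r ∣? k) + multiples lo k
      ≡⟨ cong (indicator (r ∣? k) +_) (multiples-decompose lo k) ⟩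
    indicator (r ∣? k) + (multiples 0 k + multiples k s)
      ≡⟨ x∙yz≈y∙xz (indicator (r ∣? k)) (multiples 0 k) (multiples k s) ⟩
    multiples 0 k + (indicator (r ∣? k) + multiples k s)
      ≤⟨ +-monoʳ-≤ (multiples 0 k) boundary ⟩
    multiples 0 k + 1
      ∎
    where
    open ≤-Reasoning
    s = lo % r
    boundary : indicator (r ∣? k) + multiples k s ≤ 1
    boundary with r ∣? k
    ... | no _    = multiples≤1 k s (<⇒≤ (m%n<n lo r))
    ... | yes r∣k = ≤-reflexive (cong suc (begin-equality
      multiples k s       ≡⟨ multiples-mod k s ⟩
      multiples (k % r) s ≡⟨ cong (λ y → multiples y s) (n∣m⇒m%n≡0 k r r∣k) ⟩
      multiples 0 s       ≡⟨ multiples-initial s (m%n<n lo r) ⟩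
      0                   ∎))

-- Prime powers and p-adic valuations

^-monoʳ-∣ : ∀ p {m n} → m ≤ n → p ^ m ∣ p ^ n
^-monoʳ-∣ p {m} {n} m≤n = divides (p ^ (n ∸ m)) (begin-equality
  p ^ n               ≡⟨ cong (p ^_) (m∸n+n≡m m≤n) ⟨
  p ^ (n ∸ m + m)     ≡⟨ ^-distribˡ-+-* p (n ∸ m) m ⟩
  p ^ (n ∸ m) * p ^ m ∎)
  where open ≤-Reasoning

n<m^n : ∀ {m} → 1 < m → ∀ n → n < m ^ n
n<m^n 1<m zero = s≤s z≤n
n<m^n {m} 1<m (suc n) = begin-strict
  suc n       ≤⟨ n<m^n 1<m n ⟩
  m ^ n       <⟨ m<m*n (m ^ n) m 1<m ⟩
  m ^ n * m   ≡⟨ *-comm (m ^ n) m ⟩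
  m * m ^ n   ∎
  where
  open ≤-Reasoning
  instance
    _ : NonZero (m ^ n)
    _ = m^n≢0 m n {{>-nonZero (<-trans z<s 1<m)}}

p^e∣x*y⇒split : ∀ {p} → Prime p → ∀ e {x y} → p ^ e ∣ x * y →
                ∃₂ λ e₁ e₂ → e₁ + e₂ ≡ e × p ^ e₁ ∣ x × p ^ e₂ ∣ y
p^e∣x*y⇒split pp zero h = 0 , 0 , refl , 1∣ _ , 1∣ _
p^e∣x*y⇒split {p} pp (suc e) {x} {y} h with euclidsLemma x y pp (m*n∣⇒m∣ p (p ^ e) h)
... | inj₁ (divides q refl)
    with p^e∣x*y⇒split pp e {q} {y}
           (*-cancelˡ-∣ p {{prime⇒nonZero pp}} (subst (p * p ^ e ∣_) (*-Props.xy∙z≈y∙xz q p y) h))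
...   | e₁ , e₂ , refl , p^e₁∣q , p^e₂∣y =
        suc e₁ , e₂ , refl , subst (p * p ^ e₁ ∣_) (*-comm p q) (*-monoʳ-∣ p p^e₁∣q) , p^e₂∣y
p^e∣x*y⇒split {p} pp (suc e) {x} {y} h | inj₂ (divides q refl)
    with p^e∣x*y⇒split pp e {x} {q}
           (*-cancelˡ-∣ p {{prime⇒nonZero pp}} (subst (p * p ^ e ∣_) (*-Props.x∙yz≈z∙xy x q p) h))
...   | e₁ , e₂ , refl , p^e₁∣x , p^e₂∣q =
        e₁ , suc e₂ , +-suc e₁ e₂ , p^e₁∣x , subst (p * p ^ e₂ ∣_) (*-comm p q) (*-monoʳ-∣ p p^e₂∣q)

prime>1 : ∀ {p} → Prime p → 1 < p
prime>1 {p} pp = nonTrivial⇒n>1 p {{prime⇒nonTrivial pp}}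

r^t∣n*p⇒r^t∣n : ∀ {p r t n} → Prime p → Prime r → r ≢ p → r ^ t ∣ n * p → r ^ t ∣ n
r^t∣n*p⇒r^t∣n {p} {r} {t} {n} pp pr r≢p h with p^e∣x*y⇒split pr t {n} {p} h
... | e₁ , zero   , refl , r^e₁∣n , _      = subst (λ e → r ^ e ∣ n) (sym (+-identityʳ e₁)) r^e₁∣n
... | e₁ , suc e₂ , _    , _      , r^e₂∣p with prime⇒irreducible pp (m*n∣⇒m∣ r (r ^ e₂) r^e₂∣p)
...   | inj₁ r≡1 = contradiction r≡1 (>⇒≢ (prime>1 pr))
...   | inj₂ r≡p = contradiction r≡p r≢p

infix 4 _∣[_]_
_∣[_]_ : ℕ → ℕ → ℕ → Set
m ∣[ p ] n = ∀ t → p ^ t ∣ m → p ^ t ∣ n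

p*m∣[r]n*p⇒m∣[r]n : ∀ {p r m n} → Prime p → Prime r → p * m ∣[ r ] n * p → m ∣[ r ] n
p*m∣[r]n*p⇒m∣[r]n {p} {r} {m} {n} pp pr local t r^t∣m with r ≟ p
... | yes refl = *-cancelʳ-∣ r {{prime⇒nonZero pr}}
                   (subst (_∣ n * r) (*-comm r (r ^ t)) (local (suc t) (*-monoʳ-∣ r r^t∣m)))
... | no r≢p   = r^t∣n*p⇒r^t∣n {t = t} pp pr r≢p (local t (∣-trans r^t∣m (n∣m*n p)))

productOfPrimes-∣ : ∀ {ps} → All Prime ps → ∀ {n} →
                    (∀ {p} → Prime p → product ps ∣[ p ] n) → product ps ∣ n
productOfPrimes-∣ []                      local = 1∣ _
productOfPrimes-∣ {p ∷ ps} (pp ∷ pps) {n} local with p∣n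
  where
  p∣n : p ∣ n
  p∣n = subst (_∣ n) (*-identityʳ p) (local pp 1 (*-monoʳ-∣ p (1∣ product ps)))
... | divides q refl = subst (p * product ps ∣_) (*-comm p q)
                         (*-monoʳ-∣ p (productOfPrimes-∣ pps λ pr → p*m∣[r]n*p⇒m∣[r]n pp pr (local pr)))

∣-byPrimes : ∀ {m n} .{{_ : NonZero m}} → (∀ {p} → Prime p → m ∣[ p ] n) → m ∣ n
∣-byPrimes {m} local = subst (_∣ _) (sym isFactorisation)
  (productOfPrimes-∣ factorsPrime λ pp t → local pp t ∘ subst (_ ^ t ∣_) (sym isFactorisation))
  where open PrimeFactorisation (factorise m)

-- ν p T x = min (T , v_p(x)), counted as the number of 1 ≤ j ≤ T with p ^ j ∣ x.
ν : ℕ → ℕ → ℕ → ℕ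
ν p zero    x = 0
ν p (suc T) x = ν p T x + indicator (p ^ suc T ∣? x)

ν-full : ∀ p T {x} → p ^ T ∣ x → ν p T x ≡ T
ν-full p zero    _ = refl
ν-full p (suc T) {x} p^T+1∣x with p ^ suc T ∣? x
... | yes _       =
  trans (cong (_+ 1) (ν-full p T (∣-trans (^-monoʳ-∣ p (n≤1+n T)) p^T+1∣x))) (+-comm T 1)
... | no p^T+1∤x = contradiction p^T+1∣x p^T+1∤x

p^ν∣ : ∀ p T x → p ^ ν p T x ∣ x
p^ν∣ p zero    x = 1∣ x
p^ν∣ p (suc T) x with p ^ suc T ∣? x
... | yes p^T+1∣x rewrite ν-full p T (∣-trans (^-monoʳ-∣ p (n≤1+n T)) p^T+1∣x) | +-comm T 1 = p^T+1∣x
... | no _ = subst (λ v → p ^ v ∣ x) (sym (+-identityʳ (ν p T x))) (p^ν∣ p T x)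

∣⇒≤ν : ∀ p {t T x} → t ≤ T → p ^ t ∣ x → t ≤ ν p T x
∣⇒≤ν p {T = zero}  z≤n _ = z≤n
∣⇒≤ν p {t} {suc T} {x} t≤T+1 p^t∣x with m≤n⇒m<n∨m≡n t≤T+1
... | inj₁ t<T+1 = ≤-trans (∣⇒≤ν p (m<1+n⇒m≤n t<T+1) p^t∣x) (m≤m+n (ν p T x) _)
... | inj₂ refl  = ≤-reflexive (sym (ν-full p (suc T) p^t∣x))

-- the valuation of a nonzero number is finite
¬p*m∣[p]m : ∀ {p m} → 1 < p → .{{_ : NonZero m}} → ¬ (p * m ∣[ p ] m)
¬p*m∣[p]m {p} {m} 1<p local = n≮n v (∣⇒≤ν p v<m (local (suc v) (*-monoʳ-∣ p (p^ν∣ p m m))))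
  where
  v = ν p m m
  v<m : v < m
  v<m = <-≤-trans (n<m^n 1<p v) (∣⇒≤ (p^ν∣ p m m))

m⊓n+[m<n]≤1+m⊓n : ∀ m n → m ⊓ n + indicator (m <? n) ≤ suc m ⊓ n
m⊓n+[m<n]≤1+m⊓n m n with m <? n
... | yes m<n = ≤-reflexive (begin-equality
  m ⊓ n + 1  ≡⟨ cong (_+ 1) (m≤n⇒m⊓n≡m (<⇒≤ m<n)) ⟩
  m + 1      ≡⟨ +-comm m 1 ⟩
  suc m      ≡⟨ m≤n⇒m⊓n≡m m<n ⟨
  suc m ⊓ n  ∎)
  where open ≤-Reasoning
... | no _ = ≤-trans (≤-reflexive (+-identityʳ (m ⊓ n))) (⊓-monoˡ-≤ n (n≤1+n m))

module Valuation (p : ℕ) (f : ℕ → ℕ) where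

  Σν : ℕ → List ℕ → ℕ
  Σν T []       = 0
  Σν T (i ∷ is) = ν p T (f i) + Σν T is

  ∏ : List ℕ → ℕ
  ∏ is = product (map f is)

  p^Σν∣∏ : ∀ T is → p ^ Σν T is ∣ ∏ is
  p^Σν∣∏ T []       = ∣-refl
  p^Σν∣∏ T (i ∷ is) = subst (_∣ ∏ (i ∷ is)) (sym (^-distribˡ-+-* p (ν p T (f i)) (Σν T is)))
                            (*-pres-∣ (p^ν∣ p T (f i)) (p^Σν∣∏ T is))

  ∣∏⇒≤Σν : Prime p → ∀ {t T} is → t ≤ T → p ^ t ∣ ∏ is → t ≤ Σν T is
  ∣∏⇒≤Σν pp {t} [] _ p^t∣1 with m^n≡1⇒n≡0∨m≡1 p t (∣1⇒≡1 p^t∣1)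
  ... | inj₁ refl = z≤n
  ... | inj₂ p≡1  = contradiction p≡1 (>⇒≢ (prime>1 pp))
  ∣∏⇒≤Σν pp {t} (i ∷ is) t≤T p^t∣∏ with p^e∣x*y⇒split pp t {f i} {∏ is} p^t∣∏
  ... | e₁ , e₂ , refl , p^e₁∣fi , p^e₂∣∏ =
    +-mono-≤ (∣⇒≤ν p (≤-trans (m≤m+n e₁ e₂) t≤T) p^e₁∣fi)
             (∣∏⇒≤Σν pp is (≤-trans (m≤n+m e₂ e₁) t≤T) p^e₂∣∏)

  Σν-zero : ∀ is → Σν 0 is ≡ 0
  Σν-zero []       = refl
  Σν-zero (i ∷ is) = Σν-zero is

  Σν-suc : ∀ T is → Σν (suc T) is ≡ Σν T is + countDivisible f (p ^ suc T) is
  Σν-suc T []       = refl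
  Σν-suc T (i ∷ is) =
    trans (cong (ν p T (f i) + indicator (p ^ suc T ∣? f i) +_) (Σν-suc T is))
          (interchange (ν p T (f i)) _ (Σν T is) _)

  Σν≤Σν+T⊓e : ∀ {e} is js →
              (∀ j → countDivisible f (p ^ suc j) is ≤ countDivisible f (p ^ suc j) js + indicator (j <? e)) →
              ∀ T → Σν T is ≤ Σν T js + T ⊓ e
  Σν≤Σν+T⊓e is js counts zero =
    ≤-reflexive (trans (Σν-zero is) (sym (trans (+-identityʳ _) (Σν-zero js))))
  Σν≤Σν+T⊓e {e} is js counts (suc T) = begin
    Σν (suc T) is
      ≡⟨ Σν-suc T is ⟩
    Σν T is + countDivisible f (p ^ suc T) is
      ≤⟨ +-mono-≤ (Σν≤Σν+T⊓e is js counts T) (counts T) ⟩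
    (Σν T js + T ⊓ e) + (countDivisible f (p ^ suc T) js + indicator (T <? e))
      ≡⟨ interchange (Σν T js) (T ⊓ e) _ _ ⟩
    (Σν T js + countDivisible f (p ^ suc T) js) + (T ⊓ e + indicator (T <? e))
      ≤⟨ +-mono-≤ (≤-reflexive (sym (Σν-suc T js))) (m⊓n+[m<n]≤1+m⊓n T e) ⟩
    Σν (suc T) js + suc T ⊓ e
      ∎
    where open ≤-Reasoning

  ∏∣[p]p^e*∏ : Prime p → ∀ {e} is js →
               (∀ j → countDivisible f (p ^ suc j) is ≤ countDivisible f (p ^ suc j) js + indicator (j <? e)) →
               ∏ is ∣[ p ] p ^ e * ∏ js
  ∏∣[p]p^e*∏ pp {e} is js counts t p^t∣∏is =
    ∣-trans (^-monoʳ-∣ p t≤e+Σν) (subst (_∣ p ^ e * ∏ js) (sym (^-distribˡ-+-* p e (Σν t js)))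
                                         (*-monoʳ-∣ (p ^ e) (p^Σν∣∏ t js)))
    where
    t≤e+Σν : t ≤ e + Σν t js
    t≤e+Σν = begin
      t                ≤⟨ ∣∏⇒≤Σν pp is ≤-refl p^t∣∏is ⟩
      Σν t is          ≤⟨ Σν≤Σν+T⊓e is js counts t ⟩
      Σν t js + t ⊓ e  ≤⟨ +-monoʳ-≤ (Σν t js) (m⊓n≤n t e) ⟩
      Σν t js + e      ≡⟨ +-comm (Σν t js) e ⟩
      e + Σν t js      ∎
      where open ≤-Reasoning

-- Strong divisibility sequences

m*[n-div-m]≡n : ∀ {m n} .{{_ : NonZero m}} → m ∣ n → m * (n div m) ≡ n
m*[n-div-m]≡n {suc m} = m*[n/m]≡n

∣lcmUpTo : ∀ f {k n} → 0 < k → k ≤ n → f k ∣ lcmUpTo f n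
∣lcmUpTo f {suc k} {zero} _ ()
∣lcmUpTo f {n = suc n} 0<k k≤n+1 with m≤n⇒m<n∨m≡n k≤n+1
... | inj₁ k<n+1 =
  ∣-trans (∣lcmUpTo f 0<k (m<1+n⇒m≤n k<n+1)) (m∣lcm[m,n] (lcmUpTo f n) (f (suc n)))
... | inj₂ refl  = n∣lcm[m,n] (lcmUpTo f n) (f (suc n))

lcmUpTo-least : ∀ f n {m} → (∀ k → 0 < k → k ≤ n → f k ∣ m) → lcmUpTo f n ∣ m
lcmUpTo-least f zero    _ = 1∣ _
lcmUpTo-least f (suc n) f∣m =
  lcm-least (lcmUpTo-least f n λ k 0<k k≤n → f∣m k 0<k (m≤n⇒m≤1+n k≤n)) (f∣m (suc n) z<s ≤-refl)

least<? : {P : ℕ → Set} → Decidable P → ∀ n →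
          (∀ i → i < n → ¬ P i) ⊎ ∃ λ r → r < n × P r × (∀ i → i < r → ¬ P i)
least<? P? zero = inj₁ λ _ ()
least<? P? (suc n) with least<? P? n
... | inj₂ (r , r<n , Pr , r-least) = inj₂ (r , m<n⇒m<1+n r<n , Pr , r-least)
... | inj₁ none with P? n
...   | yes Pn  = inj₂ (n , n<1+n n , Pn , none)
...   | no  ¬Pn = inj₁ λ i i<n+1 → [ none i , (λ { refl → ¬Pn }) ]′ (m<1+n⇒m<n∨m≡n i<n+1)

module StrongDivisibility (a : ℕ → ℕ) (sds : StrongDivisibilitySequence a) where

  a-nonZero : ∀ {i} → 0 < i → NonZero (a i)
  a-nonZero 0<i = proj₁ sds _ (>-nonZero 0<i)

  a-gcd : ∀ {i j} → 0 < i → 0 < j → gcd (a i) (a j) ≡ a (gcd i j)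
  a-gcd 0<i 0<j = proj₂ sds _ _ (>-nonZero 0<i) (>-nonZero 0<j)

  a-mono-∣ : ∀ {i j} → 0 < i → 0 < j → i ∣ j → a i ∣ a j
  a-mono-∣ {i} {j} 0<i 0<j i∣j =
    subst (_∣ a j) (trans (a-gcd 0<i 0<j) (cong a gcd[i,j]≡i)) (gcd[m,n]∣n (a i) (a j))
    where
    gcd[i,j]≡i : gcd i j ≡ i
    gcd[i,j]≡i = ∣-antisym (gcd[m,n]∣m i j) (gcd-greatest ∣-refl i∣j)

  rank : ∀ d n → (∀ i → 0 < i → i ≤ n → ¬ d ∣ a i) ⊎
                 ∃ λ r → 0 < r × r ≤ n × (∀ i → 0 < i → d ∣ a i ⇔ r ∣ i)
  rank d n with least<? (λ i → d ∣? a (suc i)) n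
  ... | inj₁ none = inj₁ λ { (suc i) _ i<n → none i i<n }
  ... | inj₂ (r , r<n , d∣a[1+r] , r-least) =
    inj₂ (suc r , z<s , r<n , λ i 0<i → mk⇔ (to 0<i) (from 0<i))
    where
    below-rank : ∀ i → 0 < i → i < suc r → ¬ d ∣ a i
    below-rank (suc i) _ (s≤s i<r) = r-least i i<r
    to : ∀ {i} → 0 < i → d ∣ a i → suc r ∣ i
    to {i} 0<i d∣ai with gcd i (suc r) <? suc r
    ... | yes g<1+r =
      contradiction (subst (d ∣_) (a-gcd 0<i z<s) (gcd-greatest d∣ai d∣a[1+r]))
                    (below-rank _ (n≢0⇒n>0 (gcd[m,n]≢0 i (suc r) (inj₂ λ ()))) g<1+r)
    ... | no  g≮1+r = subst (_∣ i) (≤∧≮⇒≡ (gcd[m,n]≤n i (suc r)) g≮1+r) (gcd[m,n]∣m i (suc r))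
    from : ∀ {i} → 0 < i → suc r ∣ i → d ∣ a i
    from 0<i r+1∣i = ∣-trans d∣a[1+r] (a-mono-∣ z<s 0<i r+1∣i)

  countDivisible-by-rank : ∀ {d r} → (∀ i → 0 < i → d ∣ a i ⇔ r ∣ i) → ∀ is →
                           (∀ {i} → i ∈ is → 0 < i) → countDivisible a d is ≡ count (r ∣?_) is
  countDivisible-by-rank r-rank is pos = count-cong _ _ is (λ i∈ → r-rank _ (pos i∈))

  countDivisible-initial≤ : ∀ d m k →
                            countDivisible a d (window 0 k) ≤ countDivisible a d (window m k)
  countDivisible-initial≤ d m k with rank d (m + k)
  ... | inj₁ none = ≤-trans (≤-reflexive (count-none _ (window 0 k) λ i∈ →
                      none _ (∈-window⇒>0 i∈) (≤-trans (proj₂ (∈-window i∈)) (m≤n+m k m)))) z≤n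
  ... | inj₂ (r , 0<r , _ , r-rank) =
    subst₂ _≤_ (sym (countDivisible-by-rank r-rank (window 0 k) ∈-window⇒>0))
               (sym (countDivisible-by-rank r-rank (window m k) ∈-window⇒>0))
               (Multiples.multiples-initial≤ r {{>-nonZero 0<r}} m k)

  countDivisible-k∷window≤ : ∀ d m k → 0 < k →
                       countDivisible a d (k ∷ window m k) ≤ countDivisible a d (window 0 k) + 1
  countDivisible-k∷window≤ d m k 0<k with rank d (m + k)
  ... | inj₁ none = ≤-trans (≤-reflexive (count-none _ (k ∷ window m k) λ i∈ →
                      let 0<i , i≤n = ∈-k∷window 0<k i∈ in none _ 0<i i≤n)) z≤n
  ... | inj₂ (r , 0<r , _ , r-rank) =
    subst₂ _≤_ (sym (countDivisible-by-rank r-rank (k ∷ window m k) (proj₁ ∘ ∈-k∷window 0<k)))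
               (cong (_+ 1) (sym (countDivisible-by-rank r-rank (window 0 k) ∈-window⇒>0)))
               (Multiples.indicator+multiples≤ r {{>-nonZero 0<r}} m k)

  ∏window≢0 : ∀ lo len → NonZero (product (map a (window lo len)))
  ∏window≢0 lo len = product≢0 (map⁺ (tabulate {xs = window lo len} (a-nonZero ∘ ∈-window⇒>0)))

  denom≡∏window : ∀ k → denom a k ≡ product (map a (window 0 k))
  denom≡∏window zero    = refl
  denom≡∏window (suc k) = trans (cong (_* a (suc k)) (denom≡∏window k)) (*-comm _ (a (suc k)))

  numer-suc : ∀ n k → numer a (suc n) (suc k) ≡ a (suc n) * numer a n k
  numer-suc n zero    = *-comm 1 (a (suc n))
  numer-suc n (suc k) = trans (cong (_* a (n ∸ k)) (numer-suc n k)) (*-assoc (a (suc n)) _ _)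

  numer≡∏window : ∀ m k → numer a (m + k) k ≡ product (map a (window m k))
  numer≡∏window m zero    = refl
  numer≡∏window m (suc k) = begin
    numer a (m + suc k) (suc k)         ≡⟨ cong (λ n → numer a n (suc k)) (+-suc m k) ⟩
    numer a (suc (m + k)) (suc k)       ≡⟨ numer-suc (m + k) k ⟩
    a (suc (m + k)) * numer a (m + k) k ≡⟨ cong (a (suc (m + k)) *_) (numer≡∏window m k) ⟩
    product (map a (window m (suc k)))  ∎
    where open ≡-Reasoning

  denom≢0 : ∀ k → NonZero (denom a k)
  denom≢0 k = subst NonZero (sym (denom≡∏window k)) (∏window≢0 0 k)

  denom∣numer : ∀ m k → denom a k ∣ numer a (m + k) k
  denom∣numer m k = subst₂ _∣_ (sym (denom≡∏window k)) (sym (numer≡∏window m k))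
    (∣-byPrimes {{∏window≢0 0 k}} λ {p} pp t p^t∣D →
      subst (p ^ t ∣_) (*-identityˡ _)
            (Valuation.∏∣[p]p^e*∏ p a pp {0} (window 0 k) (window m k) (counts p) t p^t∣D))
    where
    counts : ∀ p j → countDivisible a (p ^ suc j) (window 0 k)
                       ≤ countDivisible a (p ^ suc j) (window m k) + indicator (j <? 0)
    counts p j = ≤-trans (countDivisible-initial≤ (p ^ suc j) m k) (m≤m+n _ _)

  denom*binomA≡numer : ∀ m k → denom a k * binomA a (m + k) k ≡ numer a (m + k) k
  denom*binomA≡numer m k = m*[n-div-m]≡n {{denom≢0 k}} (denom∣numer m k)

  binomA≢0 : ∀ m k → NonZero (binomA a (m + k) k)
  binomA≢0 m k = m*n≢0⇒n≢0 (denom a k) {{subst NonZero (sym (denom*binomA≡numer m k)) numer≢0}}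
    where
    numer≢0 : NonZero (numer a (m + k) k)
    numer≢0 = subst NonZero (sym (numer≡∏window m k)) (∏window≢0 m k)

  p^e∣a*binomA⇒∣a : ∀ m k → 0 < k → ∀ {p} e → Prime p → p ^ suc e ∣ a k * binomA a (m + k) k →
                    ¬ (∀ i → 0 < i → i ≤ m + k → ¬ p ^ suc e ∣ a i)
  p^e∣a*binomA⇒∣a m k 0<k {p} e pp p^e+1∣a[k]*B none =
    ¬p*m∣[p]m (prime>1 pp) {{p^e*D≢0}} λ t p^t∣ → a[k]*N∣[p]p^e*D t (∣-trans p^t∣ p*[p^e*D]∣a[k]*N)
    where
    D = denom a k
    B = binomA a (m + k) k
    p^e*D≢0 : NonZero (p ^ e * D)
    p^e*D≢0 = m*n≢0 (p ^ e) D {{m^n≢0 p e {{prime⇒nonZero pp}}}} {{denom≢0 k}}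
    counts : ∀ j → countDivisible a (p ^ suc j) (k ∷ window m k)
                     ≤ countDivisible a (p ^ suc j) (window 0 k) + indicator (j <? e)
    counts j with j <? e
    ... | yes _  = countDivisible-k∷window≤ (p ^ suc j) m k 0<k
    ... | no j≮e = ≤-trans (≤-reflexive (count-none _ (k ∷ window m k) λ i∈ p^j+1∣ai →
                     let 0<i , i≤n = ∈-k∷window 0<k i∈ in
                     none _ 0<i i≤n (∣-trans (^-monoʳ-∣ p (s≤s (≮⇒≥ j≮e))) p^j+1∣ai))) z≤n
    a[k]*N∣[p]p^e*D : a k * numer a (m + k) k ∣[ p ] p ^ e * D
    a[k]*N∣[p]p^e*D =
      subst₂ (λ x y → x ∣[ p ] p ^ e * y)
             (cong (a k *_) (sym (numer≡∏window m k))) (sym (denom≡∏window k))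
             (Valuation.∏∣[p]p^e*∏ p a pp (k ∷ window m k) (window 0 k) counts)
    p*[p^e*D]∣a[k]*N : p * (p ^ e * D) ∣ a k * numer a (m + k) k
    p*[p^e*D]∣a[k]*N =
      subst₂ _∣_ (*-assoc p (p ^ e) D)
                 (trans (*-assoc (a k) B D) (cong (a k *_) (trans (*-comm B D) (denom*binomA≡numer m k))))
                 (*-monoˡ-∣ D p^e+1∣a[k]*B)

  a*binomA∣lcmUpTo : ∀ m k → 0 < k → a k * binomA a (m + k) k ∣ lcmUpTo a (m + k)
  a*binomA∣lcmUpTo m k 0<k = ∣-byPrimes {{m*n≢0 (a k) _ {{a-nonZero 0<k}} {{binomA≢0 m k}}}} local
    where
    local : ∀ {p} → Prime p → a k * binomA a (m + k) k ∣[ p ] lcmUpTo a (m + k)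
    local pp zero    _           = 1∣ _
    local {p} pp (suc e) p^e+1∣a*B with rank (p ^ suc e) (m + k)
    ... | inj₁ none = contradiction none (p^e∣a*binomA⇒∣a m k 0<k e pp p^e+1∣a*B)
    ... | inj₂ (r , 0<r , r≤n , r-rank) =
      ∣-trans (Equivalence.from (r-rank r 0<r) ∣-refl) (∣lcmUpTo a 0<r r≤n)

mainTheorem15 : (a : ℕ → ℕ) → StrongDivisibilitySequence a →
    (n : ℕ) → NonZero n →
    ((k : ℕ) → k ≤ n → denom a k ∣ numer a n k) ×
    (lcmUpTo a n ≡ lcmUpTo (λ k → a k * binomA a n k) n)
mainTheorem15 a sds n _ = integral , ∣-antisym lcm∣lcm lcm∣lcm′
  where
  open StrongDivisibility a sds
  integral : ∀ k → k ≤ n → denom a k ∣ numer a n k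
  integral k k≤n = subst (λ x → denom a k ∣ numer a x k) (m∸n+n≡m k≤n) (denom∣numer (n ∸ k) k)
  lcm∣lcm : lcmUpTo a n ∣ lcmUpTo (λ k → a k * binomA a n k) n
  lcm∣lcm = lcmUpTo-least a n λ k 0<k k≤n →
    ∣-trans (m∣m*n (binomA a n k)) (∣lcmUpTo (λ k → a k * binomA a n k) 0<k k≤n)
  lcm∣lcm′ : lcmUpTo (λ k → a k * binomA a n k) n ∣ lcmUpTo a n
  lcm∣lcm′ = lcmUpTo-least _ n λ k 0<k k≤n →
    subst (λ x → a k * binomA a x k ∣ lcmUpTo a x) (m∸n+n≡m k≤n) (a*binomA∣lcmUpTo (n ∸ k) k 0<k)
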